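{- Let $\mathcal{A}$ be a non-empty algebra in $\mathcal{C}$ and $\theta\in{\rm Con}(\mathcal{A})$. (1) If $\mathcal{B}({\rm Con}(\mathcal{A}))=\mathcal{K}(\mathcal{A})$ and $\mathcal{B}({\rm Con}(\mathcal{A}/\theta))=\mathcal{K}(\mathcal{A}/\theta)$, then $\theta$ has CBLP. (2) If every non-empty algebra $\mathcal{N}$ from $\mathcal{C}$ satisfies $\mathcal{B}({\rm Con}(\mathcal{N}))=\mathcal{K}(\mathcal{N})$, then every non-empty algebra from $\mathcal{C}$ has CBLP.
   Context: $\mathcal{C}$ is an equational class of congruence-distributive algebras of some signature, such that every non-empty algebra $\mathcal{A}$ in $\mathcal{C}$ satisfies (H): $\nabla_{\mathcal{A}}=A^2$ is compact in the congruence lattice ${\rm Con}(\mathcal{A})$. $\mathcal{K}(\mathcal{A})$ is the set of finitely generated (compact) congruences of $\mathcal{A}$; $\mathcal{B}(L)$ denotes the Boolean center of a bounded distributive lattice $L$. For $\theta\in{\rm Con}(\mathcal{A})$, $u_\theta:{\rm Con}(\mathcal{A})\to{\rm Con}(\mathcal{A}/\theta)$, $u_\theta(\alpha)=(\alpha\vee\theta)/\theta$ (with $\phi/\theta=\{(a/\theta,b/\theta)\mid(a,b)\in\phi\}$); $\theta$ has CBLP iff the restriction of $u_\theta$ from $\mathcal{B}({\rm Con}(\mathcal{A}))$ to $\mathcal{B}({\rm Con}(\mathcal{A}/\theta))$ is surjective; an algebra has CBLP iff all its congruences have CBLP. -}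

module Defs where

open import Level using (0ℓ)
open import Data.Nat using (ℕ)
open import Data.Fin using (Fin)
open import Data.Bool using (Bool; true; false)
open import Data.List using (List)
open import Data.List.Membership.Propositional using (_∈_)
open import Data.Product using (Σ; ∃; _×_; _,_)
open import Data.Unit using (⊤)
open import Relation.Binary using (Rel; IsEquivalence; _⇒_)

record Signature : Set₁ where
  field
    Op    : Set
    arity : Op → ℕ
open Signature public

data Term (S : Signature) (X : Set) : Set where
  var  : X → Term S X
  node : (f : Op S) → (Fin (arity S f) → Term S X) → Term S X

-- An algebra is a setoid (Carrier, _≈_) with operations respecting _≈_.
-- Quotient algebras are obtained by replacing _≈_ by a congruence.
record Algebra (S : Signature) : Set₁ where
  field
    Carrier : Set
    _≈_     : Rel Carrier 0ℓ
    isEquiv : IsEquivalence _≈_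
    ⟦_⟧     : (f : Op S) → (Fin (arity S f) → Carrier) → Carrier
    ⟦⟧-cong : (f : Op S) {xs ys : Fin (arity S f) → Carrier} →
              (∀ i → xs i ≈ ys i) → ⟦ f ⟧ xs ≈ ⟦ f ⟧ ys
open Algebra public

module _ {S : Signature} (A : Algebra S) where

  eval : {X : Set} → (X → Carrier A) → Term S X → Carrier A
  eval ρ (var x)     = ρ x
  eval ρ (node f ts) = ⟦ A ⟧ f (λ i → eval ρ (ts i))

  NonEmpty : Set
  NonEmpty = Carrier A

  Compatible : Rel (Carrier A) 0ℓ → Set
  Compatible R = ∀ (f : Op S) {xs ys : Fin (arity S f) → Carrier A} →
                 (∀ i → R (xs i) (ys i)) → R (⟦ A ⟧ f xs) (⟦ A ⟧ f ys)

  record Congruence : Set₁ where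
    field
      rel     : Rel (Carrier A) 0ℓ
      isCEquiv : IsEquivalence rel
      ≈⊆rel   : _≈_ A ⇒ rel
      compat  : Compatible rel
  open Congruence public

  _⊑_ : Congruence → Congruence → Set
  α ⊑ β = rel α ⇒ rel β

  _≅_ : Congruence → Congruence → Set
  α ≅ β = (α ⊑ β) × (β ⊑ α)

  data CgRel (R : Rel (Carrier A) 0ℓ) : Rel (Carrier A) 0ℓ where
    base  : ∀ {x y} → R x y → CgRel R x y
    eqv   : ∀ {x y} → _≈_ A x y → CgRel R x y
    sym′  : ∀ {x y} → CgRel R x y → CgRel R y x
    trans′ : ∀ {x y z} → CgRel R x y → CgRel R y z → CgRel R x z
    op    : ∀ (f : Op S) {xs ys : Fin (arity S f) → Carrier A} →
            (∀ i → CgRel R (xs i) (ys i)) → CgRel R (⟦ A ⟧ f xs) (⟦ A ⟧ f ys)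

  Cg : Rel (Carrier A) 0ℓ → Congruence
  Cg R = record
    { rel     = CgRel R
    ; isCEquiv = record { refl = eqv (IsEquivalence.refl (isEquiv A))
                       ; sym = sym′ ; trans = trans′ }
    ; ≈⊆rel   = eqv
    ; compat  = op }

  Δ : Congruence
  Δ = record { rel = _≈_ A ; isCEquiv = isEquiv A ; ≈⊆rel = λ p → p
             ; compat = ⟦⟧-cong A }

  ∇ : Congruence
  ∇ = record
    { rel = λ _ _ → ⊤
    ; isCEquiv = record { refl = _ ; sym = λ _ → _ ; trans = λ _ _ → _ }
    ; ≈⊆rel = λ _ → _ ; compat = λ _ _ → _ }

  ⋁ : {I : Set} → (I → Congruence) → Congruence
  ⋁ {I} αs = Cg (λ x y → Σ I λ i → rel (αs i) x y)

  _∨_ : Congruence → Congruence → Congruence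
  α ∨ β = ⋁ {Bool} (λ { true → α ; false → β })

  _∧_ : Congruence → Congruence → Congruence
  α ∧ β = record
    { rel = λ x y → rel α x y × rel β x y
    ; isCEquiv = record
        { refl  = IsEquivalence.refl (isCEquiv α) , IsEquivalence.refl (isCEquiv β)
        ; sym   = λ { (p , q) → IsEquivalence.sym (isCEquiv α) p
                                , IsEquivalence.sym (isCEquiv β) q }
        ; trans = λ { (p , q) (p′ , q′) → IsEquivalence.trans (isCEquiv α) p p′
                                        , IsEquivalence.trans (isCEquiv β) q q′ } }
    ; ≈⊆rel = λ p → ≈⊆rel α p , ≈⊆rel β p
    ; compat = λ f ps → compat α f (λ i → Data.Product.proj₁ (ps i))
                       , compat β f (λ i → Data.Product.proj₂ (ps i)) }

  ConDistributive : Set₁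
  ConDistributive = ∀ (α β γ : Congruence) → (α ∧ (β ∨ γ)) ⊑ ((α ∧ β) ∨ (α ∧ γ))

  Compact : Congruence → Set₁
  Compact α = ∀ (I : Set) (αs : I → Congruence) → α ⊑ ⋁ αs →
              ∃ λ (J : List I) → α ⊑ ⋁ {Σ I (λ i → i ∈ J)} (λ p → αs (Data.Product.proj₁ p))

  H : Set₁
  H = Compact ∇

  InK : Congruence → Set
  InK α = ∃ λ (ps : List (Carrier A × Carrier A)) →
            α ≅ Cg (λ x y → (x , y) ∈ ps)

  InB : Congruence → Set₁
  InB α = ∃ λ β → ((α ∧ β) ≅ Δ) × ((α ∨ β) ≅ ∇)

  B≡K : Set₁
  B≡K = ∀ α → ((InB α → InK α) × (InK α → InB α))

_/_ : {S : Signature} (A : Algebra S) → Congruence A → Algebra S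
A / θ = record
  { Carrier = Carrier A ; _≈_ = Congruence.rel θ ; isEquiv = Congruence.isCEquiv θ
  ; ⟦_⟧ = ⟦ A ⟧ ; ⟦⟧-cong = Congruence.compat θ }

-- u_θ(α) = (α ∨ θ)/θ, with φ/θ = {(a/θ, b/θ) | (a,b) ∈ φ}
_/ᶜ_ : {S : Signature} {A : Algebra S} (φ : Congruence A) (θ : Congruence A) →
       Rel (Carrier A) 0ℓ
_/ᶜ_ {A = A} φ θ = λ x y → ∃ λ a → ∃ λ b →
   Congruence.rel θ x a × Congruence.rel θ y b × Congruence.rel φ a b

u : {S : Signature} {A : Algebra S} (θ : Congruence A) →
    Congruence A → Congruence (A / θ)
u {A = A} θ α = Cg (A / θ) (_∨_ A α θ /ᶜ θ)
-- (the relation (α ∨ θ)/θ is already a congruence of A/θ; taking Cg of it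
--  does not change it, and avoids restating the closure proofs)

CBLP : {S : Signature} (A : Algebra S) → Congruence A → Set₁
CBLP A θ = ∀ (β : Congruence (A / θ)) → InB (A / θ) β →
           ∃ λ (α : Congruence A) → InB A α × _≅_ (A / θ) (u θ α) β

AlgCBLP : {S : Signature} → Algebra S → Set₁
AlgCBLP A = ∀ θ → CBLP A θ

Identities : Signature → Set₁
Identities S = Σ Set λ I → (I → Term S ℕ × Term S ℕ)

_∈Mod_ : {S : Signature} → Algebra S → Identities S → Set
A ∈Mod (I , E) = ∀ (i : I) (ρ : ℕ → Carrier A) →
  _≈_ A (eval A ρ (Data.Product.proj₁ (E i))) (eval A ρ (Data.Product.proj₂ (E i)))

-- If B(Con(A/θ)) = K(A/θ), a complemented congruence β of A/θ is
-- generated by a finite list ps of pairs.  The same list generates a compact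
-- congruence α = Cg_A(ps) of A, which is complemented because
-- B(Con(A)) = K(A).  Finally u_θ(Cg_A R) = Cg_{A/θ} R for every relation R,
-- so u_θ(α) = β and θ has CBLP.  Part (2) follows from part (1) because the
-- class of models of a set of identities is closed under quotients (and a
-- quotient of a non-empty algebra is non-empty: it has the same carrier).

module Submission where

open import Defs
open import Data.Product using (_×_; _,_; proj₁; proj₂)
open import Data.Bool using (true; false)
open import Data.Nat using (ℕ)
open import Data.List.Membership.Propositional using (_∈_)
open import Relation.Binary using (Rel; IsEquivalence; _⇒_)
open import Level using (0ℓ)

module Generated {S : Signature} (A : Algebra S) where

  Cg-least : (R : Rel (Carrier A) 0ℓ) (γ : Congruence A) →
             R ⇒ rel γ → _⊑_ A (Cg A R) γ
  Cg-least R γ R⊆γ (base p)     = R⊆γ p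
  Cg-least R γ R⊆γ (eqv p)      = ≈⊆rel γ p
  Cg-least R γ R⊆γ (sym′ p)     = IsEquivalence.sym (isCEquiv γ) (Cg-least R γ R⊆γ p)
  Cg-least R γ R⊆γ (trans′ p q) =
    IsEquivalence.trans (isCEquiv γ) (Cg-least R γ R⊆γ p) (Cg-least R γ R⊆γ q)
  Cg-least R γ R⊆γ (op f ps)    = compat γ f (λ i → Cg-least R γ R⊆γ (ps i))

open Generated

module _ {S : Signature} (A : Algebra S) where

  ∨-least : (α β γ : Congruence A) →
            _⊑_ A α γ → _⊑_ A β γ → _⊑_ A (_∨_ A α β) γ
  ∨-least α β γ α⊑γ β⊑γ = Cg-least A _ γ λ { (true , p) → α⊑γ p ; (false , p) → β⊑γ p }

  -- A congruence of A/θ is a congruence of A (containing θ); this is the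
  -- upper half of the correspondence Con(A/θ) ≅ [θ, ∇_A].
  lower : (θ : Congruence A) → Congruence (A / θ) → Congruence A
  lower θ γ = record
    { rel = rel γ ; isCEquiv = isCEquiv γ
    ; ≈⊆rel = λ p → ≈⊆rel γ (≈⊆rel θ p) ; compat = compat γ }

  u-Cg⊑ : (θ : Congruence A) (R : Rel (Carrier A) 0ℓ) →
          _⊑_ (A / θ) (u θ (Cg A R)) (Cg (A / θ) R)
  u-Cg⊑ θ R = Cg-least (A / θ) _ γ λ { (a , b , xa , yb , ab) →
      trans′ (eqv xa) (trans′ (Cgθ∨θ⊑γ ab) (sym′ (eqv yb))) }
    where
    γ : Congruence (A / θ)
    γ = Cg (A / θ) R
    Cgθ∨θ⊑γ : _⊑_ A (_∨_ A (Cg A R) θ) (lower θ γ)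
    Cgθ∨θ⊑γ = ∨-least (Cg A R) θ (lower θ γ)
                (Cg-least A R (lower θ γ) base) eqv

  u-Cg⊒ : (θ : Congruence A) (R : Rel (Carrier A) 0ℓ) →
          _⊑_ (A / θ) (Cg (A / θ) R) (u θ (Cg A R))
  u-Cg⊒ θ R = Cg-least (A / θ) R (u θ (Cg A R)) λ {x} {y} r →
      base (x , y , θ-refl , θ-refl , base (true , base r))
    where θ-refl = IsEquivalence.refl (isCEquiv θ)

  -- Part (1): if B = K both for A and for A/θ, then θ has CBLP.  The lift of
  -- a complemented β = Cg_{A/θ}(ps) is α = Cg_A(ps).
  CBLP-from-B≡K : (θ : Congruence A) → B≡K A → B≡K (A / θ) → CBLP A θ
  CBLP-from-B≡K θ B≡K-A B≡K-A/θ β β∈B with proj₁ (B≡K-A/θ β) β∈B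
  ... | ps , β⊑γ , γ⊑β = α , α∈B , uα⊑β , β⊑uα
    where
    P : Rel (Carrier A) 0ℓ
    P x y = (x , y) ∈ ps
    α : Congruence A
    α = Cg A P
    α∈B : InB A α
    α∈B = proj₂ (B≡K-A α) (ps , (λ p → p) , (λ p → p))
    uα⊑β : _⊑_ (A / θ) (u θ α) β
    uα⊑β p = γ⊑β (u-Cg⊑ θ P p)
    β⊑uα : _⊑_ (A / θ) β (u θ α)
    β⊑uα p = u-Cg⊒ θ P (β⊑γ p)

  eval-quotient : (θ : Congruence A) (ρ : ℕ → Carrier A) (t : Term S ℕ) →
                  rel θ (eval (A / θ) ρ t) (eval A ρ t)
  eval-quotient θ ρ (var x)     = IsEquivalence.refl (isCEquiv θ)
  eval-quotient θ ρ (node f ts) = compat θ f (λ i → eval-quotient θ ρ (ts i))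

  quotient-model : (E : Identities S) → A ∈Mod E → (θ : Congruence A) →
                   (A / θ) ∈Mod E
  quotient-model (I , E) A⊨E θ i ρ =
    θ-trans (eval-quotient θ ρ (proj₁ (E i)))
      (θ-trans (≈⊆rel θ (A⊨E i ρ)) (θ-sym (eval-quotient θ ρ (proj₂ (E i)))))
    where
    θ-trans = IsEquivalence.trans (isCEquiv θ)
    θ-sym   = IsEquivalence.sym (isCEquiv θ)

proposition4p17 : ∀ (S : Signature) (E : Identities S) →
    (∀ (A : Algebra S) → A ∈Mod E → ConDistributive A) →
    (∀ (A : Algebra S) → A ∈Mod E → NonEmpty A → H A) →
    (∀ (A : Algebra S) → A ∈Mod E → NonEmpty A → (θ : Congruence A) →
    B≡K A → B≡K (A / θ) → CBLP A θ)
    ×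
    ((∀ (N : Algebra S) → N ∈Mod E → NonEmpty N → B≡K N) →
    ∀ (A : Algebra S) → A ∈Mod E → NonEmpty A → AlgCBLP A)
proposition4p17 S E _ _ = part1 , part2
  where
  part1 : ∀ (A : Algebra S) → A ∈Mod E → NonEmpty A → (θ : Congruence A) →
          B≡K A → B≡K (A / θ) → CBLP A θ
  part1 A _ _ = CBLP-from-B≡K A

  -- A/θ is again a non-empty model of E, so B = K holds for it as well.
  part2 : (∀ (N : Algebra S) → N ∈Mod E → NonEmpty N → B≡K N) →
          ∀ (A : Algebra S) → A ∈Mod E → NonEmpty A → AlgCBLP A
  part2 B≡K-all A A⊨E a θ =
    CBLP-from-B≡K A θ (B≡K-all A A⊨E a)
      (B≡K-all (A / θ) (quotient-model A E A⊨E θ) a)
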